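{- Let $k,m,n$ be positive integers. Then $L_m^{(k)}(n)\in S_m$ if and only if $n\in S_m$.
   Context: For $m,n\in\mathbb{N}$, the Schemmel totient function $L_m(n)$ is the number of integers $k\in\{1,\dots,n\}$ such that $\gcd(k+s,n)=1$ for all $s\in\{0,1,\dots,m-1\}$; by convention $L_m(0)=0$. Equivalently, $L_m(1)=1$, and for $n>1$ with $n=\prod_{i=1}^r p_i^{\alpha_i}$, $L_m(n)=0$ if the smallest prime factor of $n$ is $\le m$, and $L_m(n)=\prod_{i} p_i^{\alpha_i-1}(p_i-m)$ otherwise. Iterates: $f^{(1)}=f$, $f^{(k+1)}=f\circ f^{(k)}$. $R_m(n)$ is the least positive integer $k$ with $L_m^{(k)}(n)\in\{0,1\}$, and $H_m(n)=L_m^{(R_m(n))}(n)$. $Q_m=\{q\text{ prime}: H_m(q)=0\}$ and $S_m=\{n\in\mathbb{N}: q\nmid n\text{ for all }q\in Q_m\}$ (in particular $0\notin S_m$). -}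

module Defs where

open import Data.Nat using (ℕ; zero; suc; _+_; _≤_; _<_)
open import Data.Nat.Properties using (_≟_)
open import Data.Nat.GCD using (gcd)
open import Data.Nat.Divisibility using (_∣_)
open import Data.Nat.Primality using (Prime)
open import Data.List using (List; length; filter; applyUpTo; upTo)
open import Data.List.Relation.Unary.All using (All; all?)
open import Data.Product using (Σ; _×_; ∃)
open import Data.Sum using (_⊎_)
open import Relation.Nullary using (¬_; Dec)
open import Relation.Binary.PropositionalEquality using (_≡_; _≢_)

Good : ℕ → ℕ → ℕ → Set
Good m n k = All (λ s → gcd (k + s) n ≡ 1) (upTo m)

good? : (m n k : ℕ) → Dec (Good m n k)
good? m n k = all? (λ s → gcd (k + s) n ≟ 1) (upTo m)

-- Schemmel totient: number of k ∈ {1,…,n} with gcd(k+s,n)=1 for all s<m.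
-- (For n = 0 the range is empty, so L m 0 = 0, matching the convention.)
L : ℕ → ℕ → ℕ
L m n = length (filter (good? m n) (applyUpTo suc n))

iter : (ℕ → ℕ) → ℕ → ℕ → ℕ
iter f zero    x = x
iter f (suc k) x = f (iter f k x)

InZeroOne : ℕ → Set
InZeroOne x = (x ≡ 0) ⊎ (x ≡ 1)

IsR : ℕ → ℕ → ℕ → Set
IsR m n k = (1 ≤ k) × InZeroOne (iter (L m) k n)
          × (∀ j → 1 ≤ j → j < k → ¬ InZeroOne (iter (L m) j n))

IsH : ℕ → ℕ → ℕ → Set
IsH m n h = Σ ℕ λ k → IsR m n k × (iter (L m) k n ≡ h)

InQ : ℕ → ℕ → Set
InQ m q = Prime q × IsH m q 0

-- n ∈ S_m : n ∈ ℕ = {1,2,…} (so 0 ∉ S_m) and no q ∈ Q_m divides n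
InS : ℕ → ℕ → Set
InS m n = (n ≢ 0) × (∀ q → InQ m q → ¬ (q ∣ n))

{-# OPTIONS --safe #-}
-- L_m(n) counts the residues k mod n with k, …, k+m−1 all prime to n.  This condition is
-- periodic mod n, so the Chinese remainder theorem makes L_m multiplicative, and
-- L_m(p·n) = p·L_m(n) when p ∣ n.  Hence d ∣ n ⇒ L_m(d) ∣ L_m(n), and every prime factor of
-- L_m(n) divides n or divides L_m(p) for some prime p ∣ n.  A prime q is in Q_m iff some
-- iterate of L_m sends q to 0; by monotonicity every multiple of q is then sent to 0 too.
-- Primes p ≤ m have L_m(p) = 0, so n ∈ S_m has no prime factor ≤ m, k = 1 is counted and
-- L_m(n) ≠ 0; and q ∈ Q_m dividing L_m(n) would give q ∣ n or a prime p ∣ n in Q_m.  So S_m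
-- is closed under L_m.  Conversely, if q ∈ Q_m divides n, the iterates of n reach 0, so
-- none of them lies in S_m.
module Submission where

open import Defs
open import Data.Nat using (ℕ; _≤_)
open import Function.Bundles using (_⇔_; mk⇔; Equivalence)

import Algebra.Properties.Semiring.Sum as SemiringSum
open import Data.Bool.Base using (true; false; if_then_else_)
open import Data.Empty using (⊥-elim)
open import Data.Fin.Base using (Fin; toℕ; fromℕ<)
open import Data.Fin.Permutation using (permutation; _⟨$⟩ʳ_)
open import Data.Fin.Properties using (toℕ-fromℕ<; toℕ<n; toℕ-injective)
open import Data.List.Base using (length; filter; applyUpTo)
open import Data.List.Properties using (filter-accept; filter-none)
open import Data.List.Relation.Unary.All as All using (All; []; _∷_)
open import Data.List.Relation.Unary.All.Properties using (applyUpTo⁺₁; applyUpTo⁻)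
open import Data.Nat.Base
open import Data.Nat.Coprimality as Coprimality
  using (Coprime; coprime⇒gcd≡1; gcd≡1⇒coprime; coprime-Bézout; coprime-divisor)
open import Data.Nat.Divisibility
open import Data.Nat.DivMod
open import Data.Nat.GCD using (gcd; gcd-zeroʳ; module Bézout)
open import Data.Nat.ListAction using (product)
open import Data.Nat.Primality using (Prime; euclidsLemma; prime⇒irreducible; prime⇒nonTrivial; prime⇒nonZero)
open import Data.Nat.Primality.Factorisation using (factorise)
open import Data.Nat.Properties
open import Data.Nat.Tactic.RingSolver using (solve-∀)
open import Data.Product.Base using (∃; ∃₂; _×_; _,_; proj₁; proj₂)
open import Data.Sum.Base using (_⊎_; inj₁; inj₂) renaming (map to ⊎-map)
open import Function.Base using (_∘_; id)
open import Relation.Binary.PropositionalEquality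
open import Relation.Nullary using (¬_; Dec; yes; no; does)
open import Relation.Nullary.Decidable using (does-⇔; _×-dec_)
open import Relation.Unary using (Pred; Decidable)

private module ℕ∑ = SemiringSum +-*-semiring

∑< : ℕ → (ℕ → ℕ) → ℕ
∑< n f = ℕ∑.sum {n} (f ∘ toℕ)

∑<-cong : ∀ n {f g : ℕ → ℕ} → (∀ {k} → k < n → f k ≡ g k) → ∑< n f ≡ ∑< n g
∑<-cong n f≗g = ℕ∑.sum-cong-≗ (λ i → f≗g (toℕ<n i))

∑<-*ˡ : ∀ n c f → c * ∑< n f ≡ ∑< n (λ k → c * f k)
∑<-*ˡ n c f = ℕ∑.*-distribˡ-sum {n} c (f ∘ toℕ)

∑<-*ʳ : ∀ n c f → ∑< n f * c ≡ ∑< n (λ k → f k * c)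
∑<-*ʳ n c f = ℕ∑.*-distribʳ-sum {n} c (f ∘ toℕ)

∑<-comm : ∀ a b (F : ℕ → ℕ → ℕ) → ∑< a (λ t → ∑< b (F t)) ≡ ∑< b (λ i → ∑< a (λ t → F t i))
∑<-comm a b F = ℕ∑.∑-comm {a} {b} (λ t i → F (toℕ t) (toℕ i))

∑<-+ : ∀ a b f → ∑< (a + b) f ≡ ∑< a f + ∑< b (λ k → f (a + k))
∑<-+ zero    b f = refl
∑<-+ (suc a) b f = trans (cong (f 0 +_) (∑<-+ a b (f ∘ suc))) (sym (+-assoc (f 0) _ _))

∑<-snoc : ∀ n f → ∑< (suc n) f ≡ ∑< n f + f n
∑<-snoc zero    f = +-comm (f 0) 0
∑<-snoc (suc n) f = trans (cong (f 0 +_) (∑<-snoc n (f ∘ suc))) (sym (+-assoc (f 0) _ _))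

∑<-const : ∀ j c → ∑< j (λ _ → c) ≡ j * c
∑<-const zero    c = refl
∑<-const (suc j) c = cong (c +_) (∑<-const j c)

∑<-blocks : ∀ j n f → ∑< (j * n) f ≡ ∑< j (λ t → ∑< n (λ i → f (t * n + i)))
∑<-blocks zero    n f = refl
∑<-blocks (suc j) n f = begin
  ∑< (n + j * n) f                                                ≡⟨ ∑<-+ n (j * n) f ⟩
  ∑< n f + ∑< (j * n) (λ k → f (n + k))                           ≡⟨ cong (∑< n f +_) (∑<-blocks j n (λ k → f (n + k))) ⟩
  ∑< n f + ∑< j (λ t → ∑< n (λ i → f (n + (t * n + i))))          ≡⟨ cong (∑< n f +_) (∑<-cong j (λ {t} _ →
                                                                        ∑<-cong n (λ {i} _ → cong f (sym (+-assoc n (t * n) i))))) ⟩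
  ∑< n f + ∑< j (λ t → ∑< n (λ i → f (suc t * n + i)))            ∎
  where open ≡-Reasoning

∑<-reindex : ∀ {n} (f σ τ : ℕ → ℕ) →
             (∀ {k} → k < n → σ k < n) → (∀ {k} → k < n → τ k < n) →
             (∀ {k} → k < n → σ (τ k) ≡ k) → (∀ {k} → k < n → τ (σ k) ≡ k) →
             ∑< n (f ∘ σ) ≡ ∑< n f
∑<-reindex {n} f σ τ σ< τ< στ τσ = begin
  ∑< n (f ∘ σ)                       ≡⟨ ℕ∑.sum-cong-≗ (λ i → cong f (sym (toℕ-fromℕ< (σ< (toℕ<n i))))) ⟩
  ℕ∑.sum (λ i → f (toℕ (π ⟨$⟩ʳ i)))  ≡⟨ sym (ℕ∑.∑-permute (f ∘ toℕ) π) ⟩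
  ∑< n f                             ∎
  where
  open ≡-Reasoning
  restrict : (g : ℕ → ℕ) → (∀ {k} → k < n → g k < n) → Fin n → Fin n
  restrict g g< i = fromℕ< (g< (toℕ<n i))
  restrict-inverse : ∀ g h (g< : ∀ {k} → k < n → g k < n) (h< : ∀ {k} → k < n → h k < n) →
                     (∀ {k} → k < n → g (h k) ≡ k) →
                     ∀ i → restrict g g< (restrict h h< i) ≡ i
  restrict-inverse g h g< h< gh i =
    toℕ-injective (trans (toℕ-fromℕ< _) (trans (cong g (toℕ-fromℕ< _)) (gh (toℕ<n i))))
  π = permutation (restrict σ σ<) (restrict τ τ<)
        (restrict-inverse σ τ σ< τ< στ) (restrict-inverse τ σ τ< σ< τσ)

Periodic : (ℕ → ℕ) → ℕ → Set
Periodic f n = ∀ k → f (k + n) ≡ f k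

periodic-+* : ∀ {f n} → Periodic f n → ∀ j k → f (k + j * n) ≡ f k
periodic-+* {f}     per zero    k = cong f (+-identityʳ k)
periodic-+* {f} {n} per (suc j) k = begin
  f (k + (n + j * n)) ≡⟨ cong f (sym (+-assoc k n (j * n))) ⟩
  f (k + n + j * n)   ≡⟨ periodic-+* per j (k + n) ⟩
  f (k + n)           ≡⟨ per k ⟩
  f k                 ∎
  where open ≡-Reasoning

periodic-% : ∀ {f n} .{{_ : NonZero n}} → Periodic f n → ∀ k → f (k % n) ≡ f k
periodic-% {f} {n} per k =
  trans (sym (periodic-+* per (k / n) (k % n))) (cong f (sym (m≡m%n+[m/n]*n k n)))

∑<-periodic : ∀ {f n} → Periodic f n → ∀ j → ∑< (j * n) f ≡ j * ∑< n f
∑<-periodic {f} {n} per j = begin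
  ∑< (j * n) f                                 ≡⟨ ∑<-blocks j n f ⟩
  ∑< j (λ t → ∑< n (λ i → f (t * n + i)))      ≡⟨ ∑<-cong j (λ {t} _ → ∑<-cong n (λ {i} _ →
                                                    trans (cong f (+-comm (t * n) i)) (periodic-+* per t i))) ⟩
  ∑< j (λ _ → ∑< n f)                          ≡⟨ ∑<-const j (∑< n f) ⟩
  j * ∑< n f                                   ∎
  where open ≡-Reasoning

∑<-rotate : ∀ {f n} → Periodic f n → ∑< n (f ∘ suc) ≡ ∑< n f
∑<-rotate {f} {n} per = +-cancelʳ-≡ (f 0) _ _ (begin
  ∑< n (f ∘ suc) + f 0  ≡⟨ +-comm _ (f 0) ⟩
  ∑< (suc n) f          ≡⟨ ∑<-snoc n f ⟩
  ∑< n f + f n          ≡⟨ cong (∑< n f +_) (per 0) ⟩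
  ∑< n f + f 0          ∎)
  where open ≡-Reasoning

[m+n*[o%d]]%d≡[m+n*o]%d : ∀ m n o d .{{_ : NonZero d}} → (m + n * (o % d)) % d ≡ (m + n * o) % d
[m+n*[o%d]]%d≡[m+n*o]%d m n o d = begin
  (m + n * (o % d)) % d                       ≡⟨ sym ([m+kn]%n≡m%n _ (n * (o / d)) d) ⟩
  (m + n * (o % d) + n * (o / d) * d) % d     ≡⟨ cong (_% d) (distribute m n (o % d) (o / d) d) ⟩
  (m + n * (o % d + o / d * d)) % d           ≡⟨ cong (λ o′ → (m + n * o′) % d) (sym (m≡m%n+[m/n]*n o d)) ⟩
  (m + n * o) % d                             ∎
  where
  open ≡-Reasoning
  distribute : ∀ m n r q d → m + n * r + n * q * d ≡ m + n * (r + q * d)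
  distribute = solve-∀

-- For x·y ≡ 1 (mod n), the map t ↦ i + x·t on residues mod n has inverse k ↦ y·(k − i),
-- where −i is represented by i·(n − 1).
module AffineResidues (n′ x y r i : ℕ) (xy≡1 : x * y ≡ 1 + r * suc n′) where
  private
    n = suc n′

  σ τ : ℕ → ℕ
  σ t = (i + x * t) % n
  τ k = (y * (i * n′) + y * k) % n

  private
    x[yz] : ∀ z → x * (y * z) ≡ z + r * z * n
    x[yz] z = begin
      x * (y * z)        ≡⟨ sym (*-assoc x y z) ⟩
      x * y * z          ≡⟨ cong (_* z) xy≡1 ⟩
      (1 + r * n) * z    ≡⟨ expand r n z ⟩
      z + r * z * n      ∎
      where
      open ≡-Reasoning
      expand : ∀ r n z → (1 + r * n) * z ≡ z + r * z * n
      expand = solve-∀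

  σ∘τ : ∀ {k} → k < n → σ (τ k) ≡ k
  σ∘τ {k} k<n = begin
    (i + x * ((y * (i * n′) + y * k) % n)) % n      ≡⟨ [m+n*[o%d]]%d≡[m+n*o]%d i x _ n ⟩
    (i + x * (y * (i * n′) + y * k)) % n            ≡⟨ cong (λ z → (i + x * z) % n) (*-distribˡ-+ y _ k) ⟨
    (i + x * (y * (i * n′ + k))) % n                ≡⟨ cong (λ z → (i + z) % n) (x[yz] _) ⟩
    (i + (i * n′ + k + r * (i * n′ + k) * n)) % n   ≡⟨ cong (_% n) (collect i n′ k r) ⟩
    (k + (i + r * (i * n′ + k)) * n) % n            ≡⟨ [m+kn]%n≡m%n k (i + r * (i * n′ + k)) n ⟩
    k % n                                           ≡⟨ m<n⇒m%n≡m k<n ⟩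
    k                                               ∎
    where
    open ≡-Reasoning
    collect : ∀ i n′ k r → i + (i * n′ + k + r * (i * n′ + k) * suc n′) ≡ k + (i + r * (i * n′ + k)) * suc n′
    collect = solve-∀

  τ∘σ : ∀ {t} → t < n → τ (σ t) ≡ t
  τ∘σ {t} t<n = begin
    (y * (i * n′) + y * ((i + x * t) % n)) % n  ≡⟨ [m+n*[o%d]]%d≡[m+n*o]%d (y * (i * n′)) y _ n ⟩
    (y * (i * n′) + y * (i + x * t)) % n        ≡⟨ cong (_% n) (regroup y i n′ x t) ⟩
    (y * i * n + x * (y * t)) % n               ≡⟨ cong (λ z → (y * i * n + z) % n) (x[yz] t) ⟩
    (y * i * n + (t + r * t * n)) % n           ≡⟨ cong (_% n) (collect y i n′ t r) ⟩
    (t + (y * i + r * t) * n) % n               ≡⟨ [m+kn]%n≡m%n t (y * i + r * t) n ⟩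
    t % n                                       ≡⟨ m<n⇒m%n≡m t<n ⟩
    t                                           ∎
    where
    open ≡-Reasoning
    regroup : ∀ y i n′ x t → y * (i * n′) + y * (i + x * t) ≡ y * i * suc n′ + x * (y * t)
    regroup = solve-∀
    collect : ∀ y i n′ t r → y * i * suc n′ + (t + r * t * suc n′) ≡ t + (y * i + r * t) * suc n′
    collect = solve-∀

∑<-affine : ∀ {n x y r} (f : ℕ → ℕ) → x * y ≡ 1 + r * n → Periodic f n → ∀ i →
            ∑< n (λ t → f (i + x * t)) ≡ ∑< n f
∑<-affine {zero}                   f _    _   _ = refl
∑<-affine {n@(suc n′)} {x} {y} {r} f xy≡1 per i = begin
  ∑< n (λ t → f (i + x * t))  ≡⟨ ∑<-cong n (λ {t} _ → periodic-% per (i + x * t)) ⟨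
  ∑< n (f ∘ σ)                ≡⟨ ∑<-reindex f σ τ (λ {t} _ → m%n<n (i + x * t) n)
                                   (λ {k} _ → m%n<n (y * (i * n′) + y * k) n) σ∘τ τ∘σ ⟩
  ∑< n f                      ∎
  where
  open ≡-Reasoning
  open AffineResidues n′ x y r i xy≡1

coprime⇒inverse : ∀ {x n} .{{_ : NonTrivial n}} → Coprime x n → ∃₂ λ y r → x * y ≡ 1 + r * n
coprime⇒inverse {x} c with coprime-Bézout c
... | Bézout.+- a b 1+bn≡ax = a , b , trans (*-comm x a) (sym 1+bn≡ax)
-- From 1 + a·x = b·n we get x·a ≡ −1, so a·(n − 1) is an inverse of x.
coprime⇒inverse {x} {n@(suc (suc q))} c | Bézout.-+ a (suc b) 1+ax≡bn =
  a * suc q , b * suc q + q , +-cancelʳ-≡ (suc q) _ _ (begin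
    x * (a * suc q) + suc q          ≡⟨ factor x a q ⟩
    (1 + a * x) * suc q              ≡⟨ cong (_* suc q) 1+ax≡bn ⟩
    suc b * n * suc q                ≡⟨ expand b q ⟩
    1 + (b * suc q + q) * n + suc q  ∎)
  where
  open ≡-Reasoning
  factor : ∀ x a q → x * (a * suc q) + suc q ≡ (1 + a * x) * suc q
  factor = solve-∀
  expand : ∀ b q → suc b * (2 + q) * suc q ≡ 1 + (b * suc q + q) * (2 + q) + suc q
  expand = solve-∀

𝟙 : ∀ {a} {A : Set a} → Dec A → ℕ
𝟙 a? = if does a? then 1 else 0

𝟙-⇔ : ∀ {a b} {A : Set a} {B : Set b} → A ⇔ B → (a? : Dec A) (b? : Dec B) → 𝟙 a? ≡ 𝟙 b?
𝟙-⇔ A⇔B a? b? = cong (λ t → if t then 1 else 0) (does-⇔ A⇔B a? b?)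

𝟙-×-dec : ∀ {a b} {A : Set a} {B : Set b} (a? : Dec A) (b? : Dec B) → 𝟙 (a? ×-dec b?) ≡ 𝟙 a? * 𝟙 b?
𝟙-×-dec a? b? with does a? | does b?
... | true  | true  = refl
... | true  | false = refl
... | false | _     = refl

length-filter-applyUpTo : ∀ {p} {P : Pred ℕ p} (P? : Decidable P) f n →
                          length (filter P? (applyUpTo f n)) ≡ ∑< n (λ k → 𝟙 (P? (f k)))
length-filter-applyUpTo P? f zero = refl
length-filter-applyUpTo P? f (suc n) with does (P? (f 0))
... | true  = cong suc (length-filter-applyUpTo P? (f ∘ suc) n)
... | false = length-filter-applyUpTo P? (f ∘ suc) n

coprime-*⇔ : ∀ {a b c} → Coprime a (b * c) ⇔ (Coprime a b × Coprime a c)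
coprime-*⇔ {a} {b} {c} = mk⇔
  (λ a⊥bc → (λ {_} (i∣a , i∣b) → a⊥bc (i∣a , ∣m⇒∣m*n c i∣b)) , (λ {_} (i∣a , i∣c) → a⊥bc (i∣a , ∣n⇒∣m*n b i∣c)))
  (λ (a⊥b , a⊥c) {i} (i∣a , i∣bc) → a⊥c (i∣a , coprime-divisor (λ {_} (j∣i , j∣b) → a⊥b (∣-trans j∣i i∣a , j∣b)) i∣bc))

coprime-+⇔ : ∀ {a n} → Coprime (a + n) n ⇔ Coprime a n
coprime-+⇔ {a} {n} = mk⇔
  (λ a+n⊥n {i} (i∣a , i∣n) → a+n⊥n (∣m∣n⇒∣m+n i∣a i∣n , i∣n))
  (λ a⊥n {i} (i∣a+n , i∣n) → a⊥n (∣m+n∣m⇒∣n (subst (i ∣_) (+-comm a n) i∣a+n) i∣n , i∣n))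

Good-map : ∀ {m n n′} k k′ → (∀ {s} → Coprime (k + s) n → Coprime (k′ + s) n′) →
           Good m n k → Good m n′ k′
Good-map {n = n} {n′} k k′ f =
  All.map (λ {s} e → coprime⇒gcd≡1 {k′ + s} {n′} (f (gcd≡1⇒coprime {k + s} {n} e)))

Good-+⇔ : ∀ m n k → Good m n (k + n) ⇔ Good m n k
Good-+⇔ m n k = mk⇔
  (Good-map (k + n) k (λ {s} → Equivalence.to coprime-+⇔ ∘ subst (λ z → Coprime z n) (shuffle s)))
  (Good-map k (k + n) (λ {s} → subst (λ z → Coprime z n) (sym (shuffle s)) ∘ Equivalence.from coprime-+⇔))
  where
  shuffle : ∀ s → k + n + s ≡ k + s + n
  shuffle s = trans (+-assoc k n s) (trans (cong (k +_) (+-comm n s)) (sym (+-assoc k s n)))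

Good-*⇔ : ∀ m a b k → Good m (a * b) k ⇔ (Good m a k × Good m b k)
Good-*⇔ m a b k = mk⇔
  (λ g → Good-map k k (proj₁ ∘ Equivalence.to (coprime-*⇔ {c = b})) g ,
         Good-map k k (proj₂ ∘ Equivalence.to (coprime-*⇔ {b = a})) g)
  (All.zipWith (λ {s} (e₁ , e₂) → coprime⇒gcd≡1 {k + s} {a * b} (Equivalence.from coprime-*⇔
     (gcd≡1⇒coprime {k + s} {a} e₁ , gcd≡1⇒coprime {k + s} {b} e₂))))

Good-*-∣⇔ : ∀ m {d n} k → d ∣ n → Good m (d * n) k ⇔ Good m n k
Good-*-∣⇔ m {d} {n} k d∣n = mk⇔
  (proj₂ ∘ Equivalence.to (Good-*⇔ m d n k))
  (λ g → Equivalence.from (Good-*⇔ m d n k)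
     (Good-map k k (λ k+s⊥n {_} (i∣k+s , i∣d) → k+s⊥n (i∣k+s , ∣-trans i∣d d∣n)) g , g))

χ : ℕ → ℕ → ℕ → ℕ
χ m n k = 𝟙 (good? m n k)

χ-periodic : ∀ m n → Periodic (χ m n) n
χ-periodic m n k = 𝟙-⇔ (Good-+⇔ m n k) (good? m n (k + n)) (good? m n k)

χ-* : ∀ m a b k → χ m (a * b) k ≡ χ m a k * χ m b k
χ-* m a b k = trans (𝟙-⇔ (Good-*⇔ m a b k) (good? m (a * b) k) (good? m a k ×-dec good? m b k))
                    (𝟙-×-dec (good? m a k) (good? m b k))

χ-*-∣ : ∀ m {d n} → d ∣ n → ∀ k → χ m (d * n) k ≡ χ m n k
χ-*-∣ m {d} {n} d∣n k = 𝟙-⇔ (Good-*-∣⇔ m k d∣n) (good? m (d * n) k) (good? m n k)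

-- L counts k ∈ {1,…,n}; periodicity lets the sum run over k ∈ {0,…,n-1} instead.
L≡∑<χ : ∀ m n → L m n ≡ ∑< n (χ m n)
L≡∑<χ m n = trans (length-filter-applyUpTo (good? m n) suc n) (∑<-rotate (χ-periodic m n))

L[1]≡1 : ∀ m → L m 1 ≡ 1
L[1]≡1 m = cong length (filter-accept (good? m 1) (applyUpTo⁺₁ id m (λ {s} _ → gcd-zeroʳ (1 + s))))

L-*-∣ : ∀ m {d n} → d ∣ n → L m (d * n) ≡ d * L m n
L-*-∣ m {d} {n} d∣n = begin
  L m (d * n)               ≡⟨ L≡∑<χ m (d * n) ⟩
  ∑< (d * n) (χ m (d * n))  ≡⟨ ∑<-cong (d * n) (λ {k} _ → χ-*-∣ m d∣n k) ⟩
  ∑< (d * n) (χ m n)        ≡⟨ ∑<-periodic (χ-periodic m n) d ⟩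
  d * ∑< n (χ m n)          ≡⟨ cong (d *_) (L≡∑<χ m n) ⟨
  d * L m n                 ∎
  where open ≡-Reasoning

-- Chinese remainder theorem: split k < a·b as t·b + i and use that b is a unit mod a.
L-multiplicative : ∀ m {a b} → Coprime a b → L m (a * b) ≡ L m a * L m b
L-multiplicative m {zero}        _ = refl
L-multiplicative m {suc zero} {b} _ = begin
  L m (1 * b)      ≡⟨ cong (L m) (*-identityˡ b) ⟩
  L m b            ≡⟨ *-identityˡ (L m b) ⟨
  1 * L m b        ≡⟨ cong (_* L m b) (L[1]≡1 m) ⟨
  L m 1 * L m b    ∎
  where open ≡-Reasoning
L-multiplicative m {a@(suc (suc _))} {b} a⊥b with coprime⇒inverse (Coprimality.sym a⊥b)
... | y , r , by≡1 = begin
  L m (a * b)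
    ≡⟨ L≡∑<χ m (a * b) ⟩
  ∑< (a * b) (χ m (a * b))
    ≡⟨ ∑<-cong (a * b) (λ {k} _ → χ-* m a b k) ⟩
  ∑< (a * b) (λ k → χ m a k * χ m b k)
    ≡⟨ ∑<-blocks a b (λ k → χ m a k * χ m b k) ⟩
  ∑< a (λ t → ∑< b (λ i → χ m a (t * b + i) * χ m b (t * b + i)))
    ≡⟨ ∑<-cong a (λ {t} _ → ∑<-cong b (λ {i} _ → reduce t i)) ⟩
  ∑< a (λ t → ∑< b (λ i → χ m a (i + b * t) * χ m b i))
    ≡⟨ ∑<-comm a b (λ t i → χ m a (i + b * t) * χ m b i) ⟩
  ∑< b (λ i → ∑< a (λ t → χ m a (i + b * t) * χ m b i))
    ≡⟨ ∑<-cong b (λ {i} _ → ∑<-*ʳ a (χ m b i) (λ t → χ m a (i + b * t))) ⟨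
  ∑< b (λ i → ∑< a (λ t → χ m a (i + b * t)) * χ m b i)
    ≡⟨ ∑<-cong b (λ {i} _ → cong (_* χ m b i) (∑<-affine {x = b} {y} {r} (χ m a) by≡1 (χ-periodic m a) i)) ⟩
  ∑< b (λ i → ∑< a (χ m a) * χ m b i)
    ≡⟨ ∑<-*ˡ b (∑< a (χ m a)) (χ m b) ⟨
  ∑< a (χ m a) * ∑< b (χ m b)
    ≡⟨ cong₂ _*_ (L≡∑<χ m a) (L≡∑<χ m b) ⟨
  L m a * L m b
    ∎
  where
  open ≡-Reasoning
  reduce : ∀ t i → χ m a (t * b + i) * χ m b (t * b + i) ≡ χ m a (i + b * t) * χ m b i
  reduce t i = cong₂ _*_
    (cong (χ m a) (trans (+-comm (t * b) i) (cong (i +_) (*-comm t b))))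
    (trans (cong (χ m b) (+-comm (t * b) i)) (periodic-+* (χ-periodic m b) t i))

prime-induction : ∀ {ℓ} (P : ℕ → Set ℓ) → P 1 → (∀ {p n} → Prime p → P n → P (p * n)) →
                  ∀ n .{{_ : NonZero n}} → P n
prime-induction P P[1] P[p*n] n with factorise n
... | record { factors = ps ; isFactorisation = n≡∏ps ; factorsPrime = ps-prime } =
  subst P (sym n≡∏ps) (over ps-prime)
  where
  over : ∀ {ps} → All Prime ps → P (product ps)
  over []            = P[1]
  over (pp ∷ ps-prime) = P[p*n] pp (over ps-prime)

prime≢1 : ∀ {p} → Prime p → p ≢ 1
prime≢1 pp = nonTrivial⇒≢1 {{prime⇒nonTrivial pp}}

∃-prime-divisor : ∀ n .{{_ : NonZero n}} → n ≢ 1 → ∃ λ p → Prime p × p ∣ n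
∃-prime-divisor = prime-induction (λ n → n ≢ 1 → ∃ λ p → Prime p × p ∣ n)
  (λ 1≢1 → ⊥-elim (1≢1 refl)) (λ {p} {n} pp _ _ → p , pp , m∣m*n n)

prime∤⇒coprime : ∀ {p n} → Prime p → ¬ p ∣ n → Coprime p n
prime∤⇒coprime pp p∤n (i∣p , i∣n) with prime⇒irreducible pp i∣p
... | inj₁ i≡1 = i≡1
... | inj₂ refl = ⊥-elim (p∤n i∣n)

-- Every k ∈ {1,…,p} is bad: the window k, …, k+m-1 reaches p.
L[p]≡0 : ∀ m {p} → Prime p → p ≤ m → L m p ≡ 0
L[p]≡0 m {p} pp p≤m = cong length (filter-none (good? m p) (applyUpTo⁺₁ suc p bad))
  where
  bad : ∀ {k} → k < p → ¬ Good m p (suc k)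
  bad {k} k<p g = prime≢1 pp (p⊥p (∣-refl , ∣-refl))
    where
    p∸k<m : p ∸ suc k < m
    p∸k<m = <-≤-trans (∸-monoʳ-< {p} {suc k} {0} z<s k<p) p≤m
    p⊥p : Coprime p p
    p⊥p = gcd≡1⇒coprime {p} {p} (subst (λ z → gcd z p ≡ 1) (m+[n∸m]≡n k<p) (applyUpTo⁻ id m g p∸k<m))

-- k = 1 is good: a common divisor of n and some j ≤ m would have a prime factor ≤ m.
L≢0 : ∀ m {n} → n ≢ 0 → (∀ {p} → Prime p → p ≤ m → ¬ p ∣ n) → L m n ≢ 0
L≢0 m {zero}  0≢0 _ = ⊥-elim (0≢0 refl)
L≢0 m {suc n} _ no-small-prime L≡0 =
  1+n≢0 (trans (sym (cong length (filter-accept (good? m (suc n)) one-good))) L≡0)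
  where
  one-good : Good m (suc n) 1
  one-good = applyUpTo⁺₁ id m (λ {s} s<m → coprime⇒gcd≡1 {suc s} {suc n} (small⊥n s<m))
    where
    small⊥n : ∀ {s} → s < m → Coprime (suc s) (suc n)
    small⊥n {s} s<m {i} (i∣1+s , i∣n) with i ≟ 1
    ... | yes i≡1 = i≡1
    ... | no  i≢1 with ∃-prime-divisor i {{≢-nonZero (λ { refl → 1+n≢0 (0∣⇒≡0 i∣n) })}} i≢1
    ...   | p , pp , p∣i = ⊥-elim (no-small-prime pp (≤-trans (∣⇒≤ (∣-trans p∣i i∣1+s)) s<m) (∣-trans p∣i i∣n))

L-prime-* : ∀ m {p} → Prime p → ∀ n → L m (p * n) ≡ p * L m n ⊎ L m (p * n) ≡ L m p * L m n
L-prime-* m {p} pp n with p ∣? n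
... | yes p∣n = inj₁ (L-*-∣ m p∣n)
... | no  p∤n = inj₂ (L-multiplicative m (prime∤⇒coprime pp p∤n))

L[n]∣L[p*n] : ∀ m {p} → Prime p → ∀ n → L m n ∣ L m (p * n)
L[n]∣L[p*n] m {p} pp n with L-prime-* m pp n
... | inj₁ L[p*n]≡ = subst (L m n ∣_) (sym L[p*n]≡) (n∣m*n p)
... | inj₂ L[p*n]≡ = subst (L m n ∣_) (sym L[p*n]≡) (n∣m*n (L m p))

L[n]∣L[d*n] : ∀ m d n → L m n ∣ L m (d * n)
L[n]∣L[d*n] m zero      n = L m n ∣0
L[n]∣L[d*n] m d@(suc _) n = prime-induction (λ d → L m n ∣ L m (d * n)) base step d
  where
  base : L m n ∣ L m (1 * n)
  base = subst (λ x → L m n ∣ L m x) (sym (*-identityˡ n)) ∣-refl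
  step : ∀ {p e} → Prime p → L m n ∣ L m (e * n) → L m n ∣ L m (p * e * n)
  step {p} {e} pp ih =
    ∣-trans ih (subst (λ x → L m (e * n) ∣ L m x) (sym (*-assoc p e n)) (L[n]∣L[p*n] m pp (e * n)))

L-mono-∣ : ∀ m {d n} → d ∣ n → L m d ∣ L m n
L-mono-∣ m {d} (divides q refl) = L[n]∣L[d*n] m q d

prime∣L⇒ : ∀ m {q} → Prime q → ∀ n → q ∣ L m n → q ∣ n ⊎ ∃ λ p → Prime p × p ∣ n × q ∣ L m p
prime∣L⇒ m     pq zero      _ = inj₁ (_ ∣0)
prime∣L⇒ m {q} pq n@(suc _)   = prime-induction Claim base step n
  where
  Conclusion : ℕ → Set
  Conclusion n = q ∣ n ⊎ ∃ λ p → Prime p × p ∣ n × q ∣ L m p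
  Claim : ℕ → Set
  Claim n = q ∣ L m n → Conclusion n
  base : Claim 1
  base q∣L[1] = ⊥-elim (prime≢1 pq (∣1⇒≡1 (subst (q ∣_) (L[1]≡1 m) q∣L[1])))
  extend : ∀ {p n} → Conclusion n → Conclusion (p * n)
  extend {p} = ⊎-map (∣n⇒∣m*n p) (λ (r , pr , r∣n , q∣L[r]) → r , pr , ∣n⇒∣m*n p r∣n , q∣L[r])
  step : ∀ {p n} → Prime p → Claim n → Claim (p * n)
  step {p} {n} pp ih q∣L with L-prime-* m pp n
  ... | inj₁ L≡ with euclidsLemma p (L m n) pq (subst (q ∣_) L≡ q∣L)
  ...   | inj₁ q∣p     = inj₁ (∣m⇒∣m*n n q∣p)
  ...   | inj₂ q∣L[n]  = extend {p} (ih q∣L[n])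
  step {p} {n} pp ih q∣L | inj₂ L≡ with euclidsLemma (L m p) (L m n) pq (subst (q ∣_) L≡ q∣L)
  ...   | inj₁ q∣L[p]  = inj₂ (p , pp , m∣m*n n , q∣L[p])
  ...   | inj₂ q∣L[n]  = extend {p} (ih q∣L[n])

iter-+ : ∀ (f : ℕ → ℕ) j k x → iter f (j + k) x ≡ iter f j (iter f k x)
iter-+ f zero    k x = refl
iter-+ f (suc j) k x = cong f (iter-+ f j k x)

iter-comm : ∀ (f : ℕ → ℕ) j k x → iter f j (iter f k x) ≡ iter f k (iter f j x)
iter-comm f j k x = begin
  iter f j (iter f k x)  ≡⟨ iter-+ f j k x ⟨
  iter f (j + k) x       ≡⟨ cong (λ i → iter f i x) (+-comm j k) ⟩
  iter f (k + j) x       ≡⟨ iter-+ f k j x ⟩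
  iter f k (iter f j x)  ∎
  where open ≡-Reasoning

iter-∸ : ∀ (f : ℕ → ℕ) {i k} x → k ≤ i → iter f i x ≡ iter f (i ∸ k) (iter f k x)
iter-∸ f {i} {k} x k≤i = trans (cong (λ l → iter f l x) (sym (m∸n+n≡m k≤i))) (iter-+ f (i ∸ k) k x)

iter-fixed : ∀ {f : ℕ → ℕ} {x} → f x ≡ x → ∀ j → iter f j x ≡ x
iter-fixed     fx≡x zero    = refl
iter-fixed {f} fx≡x (suc j) = trans (cong f (iter-fixed fx≡x j)) fx≡x

iter-mono : ∀ {ℓ} {f : ℕ → ℕ} {_∼_ : ℕ → ℕ → Set ℓ} → (∀ {a b} → a ∼ b → f a ∼ f b) →
            ∀ {a b} → a ∼ b → ∀ j → iter f j a ∼ iter f j b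
iter-mono f-mono a∼b zero    = a∼b
iter-mono {f = f} {_∼_} f-mono a∼b (suc j) = f-mono (iter-mono {f = f} {_∼_} f-mono a∼b j)

least-positive : ∀ {p} {P : Pred ℕ p} → Decidable P → ∀ {n} → 1 ≤ n → P n →
                 ∃ λ k → 1 ≤ k × P k × (∀ j → 1 ≤ j → j < k → ¬ P j)
least-positive {P = P} P? {n} 1≤n Pn =
  search (n ∸ 1) 1 ≤-refl (λ { _ (s≤s _) (s≤s ()) }) (subst P (sym (m∸n+n≡m 1≤n)) Pn)
  where
  search : ∀ d k → 1 ≤ k → (∀ j → 1 ≤ j → j < k → ¬ P j) → P (d + k) →
           ∃ λ k → 1 ≤ k × P k × (∀ j → 1 ≤ j → j < k → ¬ P j)
  search d k 1≤k below P[d+k] with P? k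
  ... | yes Pk = k , 1≤k , Pk , below
  search zero    k 1≤k below Pk      | no ¬Pk = ⊥-elim (¬Pk Pk)
  search (suc d) k 1≤k below P[d+k] | no ¬Pk =
    search d (suc k) (m≤n⇒m≤1+n 1≤k) below′ (subst P (sym (+-suc d k)) P[d+k])
    where
    below′ : ∀ j → 1 ≤ j → j < suc k → ¬ P j
    below′ j 1≤j j<1+k with m<1+n⇒m<n∨m≡n j<1+k
    ... | inj₁ j<k  = below j 1≤j j<k
    ... | inj₂ refl = ¬Pk

InZeroOne? : ∀ x → Dec (InZeroOne x)
InZeroOne? 0             = yes (inj₁ refl)
InZeroOne? 1             = yes (inj₂ refl)
InZeroOne? (suc (suc x)) = no λ { (inj₁ ()) ; (inj₂ ()) }

EventuallyZero : ℕ → ℕ → Set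
EventuallyZero m n = ∃ λ j → iter (L m) j n ≡ 0

EventuallyZero-∣ : ∀ {m q n} → EventuallyZero m q → q ∣ n → EventuallyZero m n
EventuallyZero-∣ {m} (j , e) q∣n = j , 0∣⇒≡0 (subst (_∣ _) e (iter-mono {f = L m} {_∼_ = _∣_} (L-mono-∣ m) q∣n j))

EventuallyZero-iter : ∀ {m n} → EventuallyZero m n → ∀ k → EventuallyZero m (iter (L m) k n)
EventuallyZero-iter {m} {n} (j , e) k =
  j , trans (iter-comm (L m) j k n) (trans (cong (iter (L m) k) e) (iter-fixed refl k))

EventuallyZero-L⁻ : ∀ {m n} → EventuallyZero m (L m n) → EventuallyZero m n
EventuallyZero-L⁻ {m} {n} (j , e) = suc j , trans (sym (iter-comm (L m) j 1 n)) e

InQ⇒EventuallyZero : ∀ {m q} → InQ m q → EventuallyZero m q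
InQ⇒EventuallyZero (_ , k , _ , e) = k , e

-- Since L fixes 0 and 1, an orbit that reaches 0 cannot have stopped at 1 first.
EventuallyZero⇒InQ : ∀ {m q} → Prime q → EventuallyZero m q → InQ m q
EventuallyZero⇒InQ pq (zero , refl) = ⊥-elim (≢-nonZero⁻¹ 0 {{prime⇒nonZero pq}} refl)
EventuallyZero⇒InQ {m} {q} pq (suc j , L^j≡0)
  with least-positive (λ k → InZeroOne? (iter (L m) k q)) {suc j} (s≤s z≤n) (inj₁ L^j≡0)
... | k , isR@(_ , inj₁ L^k≡0 , _) = pq , k , isR , L^k≡0
... | k , (_ , inj₂ L^k≡1 , below) with k ≤? suc j
...   | yes k≤1+j = ⊥-elim (0≢1+n (begin
          0                                        ≡⟨ L^j≡0 ⟨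
          iter (L m) (suc j) q                     ≡⟨ iter-∸ (L m) q k≤1+j ⟩
          iter (L m) (suc j ∸ k) (iter (L m) k q)  ≡⟨ cong (iter (L m) (suc j ∸ k)) L^k≡1 ⟩
          iter (L m) (suc j ∸ k) 1                 ≡⟨ iter-fixed (L[1]≡1 m) (suc j ∸ k) ⟩
          1                                        ∎))
  where open ≡-Reasoning
...   | no  k≰1+j = ⊥-elim (below (suc j) (s≤s z≤n) (≰⇒> k≰1+j) (inj₁ L^j≡0))

prime≤⇒InQ : ∀ {m p} → Prime p → p ≤ m → InQ m p
prime≤⇒InQ {m} pp p≤m = EventuallyZero⇒InQ pp (1 , L[p]≡0 m pp p≤m)

InS-L : ∀ {m n} → InS m n → InS m (L m n)
InS-L {m} {n} (n≢0 , Q∤n) = L≢0 m n≢0 (λ pp p≤m → Q∤n _ (prime≤⇒InQ pp p≤m)) , Q∤L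
  where
  Q∤L : ∀ q → InQ m q → ¬ q ∣ L m n
  Q∤L q q∈Q q∣L with prime∣L⇒ m (proj₁ q∈Q) n q∣L
  ... | inj₁ q∣n                      = Q∤n q q∈Q q∣n
  ... | inj₂ (p , pp , p∣n , q∣L[p]) =
    Q∤n p (EventuallyZero⇒InQ pp (EventuallyZero-L⁻ (EventuallyZero-∣ (InQ⇒EventuallyZero q∈Q) q∣L[p]))) p∣n

InS-iter : ∀ {m n} → InS m n → ∀ k → InS m (iter (L m) k n)
InS-iter n∈S zero    = n∈S
InS-iter n∈S (suc k) = InS-L (InS-iter n∈S k)

InS-iter⁻ : ∀ {m n} k → InS m (iter (L m) k n) → InS m n
InS-iter⁻ {m} {n} k Lᵏn∈S = n≢0 , Q∤n
  where
  n≢0 : n ≢ 0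
  n≢0 refl = proj₁ Lᵏn∈S (iter-fixed refl k)
  Q∤n : ∀ q → InQ m q → ¬ q ∣ n
  Q∤n q q∈Q q∣n with EventuallyZero-iter (EventuallyZero-∣ (InQ⇒EventuallyZero q∈Q) q∣n) k
  ... | j , Lʲ⁺ᵏn≡0 = proj₁ (InS-iter Lᵏn∈S j) Lʲ⁺ᵏn≡0

corollary1p1 : (k m n : ℕ) → 1 ≤ k → 1 ≤ m → 1 ≤ n →
    (InS m (iter (L m) k n) ⇔ InS m n)
corollary1p1 k m n _ _ _ = mk⇔ (InS-iter⁻ k) (λ n∈S → InS-iter n∈S k)
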